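{- Let $\mathbf u\in\mathbb{N}_{>0}^r$. A binary operation $\circ$ on $E_{\mathbf u}$ satisfies (S1) and (S2) if and only if for each $a\in E_{\mathbf u}$ there exists a unique matrix $M_a\in M_r(\mathbb{N})$ with $M_a\mathbf u\le \mathbf u$ coordinatewise such that $a\circ x=M_ax$ for all $x\in E_{\mathbf u}$, and $M_{\mathbf u}=I_r$. Conversely, any family $(M_a)_{a\in E_{\mathbf u}}$ of matrices in $M_r(\mathbb{N})$ with $M_a\mathbf u\le\mathbf u$ for all $a$ and $M_{\mathbf u}=I_r$ defines, via $a\circ x=M_ax$, an operation satisfying (S1) and (S2).
   Context: For $\mathbf u\in\mathbb{N}_{>0}^r$, $E_{\mathbf u}=\{x\in\mathbb{Z}_{\ge0}^r:0\le x\le\mathbf u\}$ is the effect algebra with partial addition $x\oplus y=x+y$ defined (written $x\perp y$) iff $x+y\le \mathbf u$, top element $\mathbf u$. Axioms for a total binary operation $\circ$: (S1) $b\perp c\Rightarrow a\circ(b\oplus c)=(a\circ b)\oplus(a\circ c)$; (S2) $\mathbf u\circ a=a$ (the top element acts as left identity). -}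

module Defs where

open import Data.Nat using (ℕ; _+_; _*_; _≤_; _<_)
open import Data.Fin using (Fin; _≟_)
open import Data.Vec using (Vec; zipWith; map; tabulate; sum)
open import Data.Vec.Relation.Binary.Pointwise.Inductive using (Pointwise)
open import Data.Bool using (if_then_else_)
open import Relation.Nullary using (does)
open import Relation.Binary.PropositionalEquality using (_≡_)
open import Data.Product using (_×_; ∃!)

_≤v_ : ∀ {r} → Vec ℕ r → Vec ℕ r → Set
_≤v_ = Pointwise _≤_

_+v_ : ∀ {r} → Vec ℕ r → Vec ℕ r → Vec ℕ r
_+v_ = zipWith _+_

-- r × r matrices over ℕ, as a vector of rows
Matrix : ℕ → Set
Matrix r = Vec (Vec ℕ r) r

_·_ : ∀ {r} → Matrix r → Vec ℕ r → Vec ℕ r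
M · x = map (λ row → sum (zipWith _*_ row x)) M

I : ∀ r → Matrix r
I r = tabulate λ i → tabulate λ j → if does (i ≟ j) then 1 else 0

module _ {r : ℕ} (u : Vec ℕ r) where

  record E : Set where
    constructor ⟨_,_⟩
    field
      vec   : Vec ℕ r
      bound : vec ≤v u
  open E public

  top : u ≤v u → E
  top p = ⟨ u , p ⟩

  _⊥_ : E → E → Set
  x ⊥ y = (vec x +v vec y) ≤v u

  ⊕ : (x y : E) → x ⊥ y → E
  ⊕ x y h = ⟨ vec x +v vec y , h ⟩

  -- (S1): b ⊥ c ⇒ a∘(b⊕c) = (a∘b) ⊕ (a∘c)  (the right side being defined)
  S1 : (E → E → E) → Set
  S1 _∘_ = ∀ a b c → (h : b ⊥ c) →
    ((a ∘ b) ⊥ (a ∘ c)) × (vec (a ∘ ⊕ b c h) ≡ vec (a ∘ b) +v vec (a ∘ c))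

  S2 : (E → E → E) → Set
  S2 _∘_ = ∀ (p : u ≤v u) a → vec (top p ∘ a) ≡ vec a

  Represents : (E → E → E) → E → Matrix r → Set
  Represents _∘_ a M = ((M · u) ≤v u) × (∀ x → vec (a ∘ x) ≡ M · vec x)

-- Axiom (S1) says that every left translation x ↦ a ∘ x is additive on E_u.
-- Since all u_i > 0, the unit vectors e_j lie in E_u, and every nonzero
-- x ∈ E_u splits as e_j ⊕ x' with x' ∈ E_u (E_u is a down-set).  Hence an
-- additive map on E_u is the matrix whose j-th column is its value at e_j,
-- and this matrix is determined by those values.  M_a u ≤ u because a ∘ u lies
-- in E_u, and (S2) says exactly M_u = I.  Conversely, multiplication by a
-- matrix is additive and monotone, so it maps E_u into itself once M u ≤ u.
module Submission where

open import Defs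
open import Data.Nat using (ℕ; zero; suc; _+_; _*_; _≤_; _<_; z≤n)
open import Data.Nat.Properties
  using (≤-refl; ≤-trans; ≤-irrelevant; m≤n+m; +-mono-≤; *-monoʳ-≤; *-comm; *-zeroʳ;
         *-identityʳ; +-identityˡ; +-identityʳ; *-distribˡ-+; +-cancelˡ-≡; suc-injective;
         +-commutativeSemigroup)
open import Algebra.Properties.CommutativeSemigroup +-commutativeSemigroup using (interchange)
open import Data.Bool using (if_then_else_)
open import Data.Fin using (Fin; zero; suc; _≟_)
open import Data.Vec using (Vec; []; _∷_; replicate; tabulate; lookup; zipWith; sum)
open import Data.Vec.Properties
  using (∷-injective; lookup-map; lookup-zipWith; lookup∘tabulate;
         map-cong; map-const; zipWith-comm; zipWith-identityˡ)
open import Data.Vec.Relation.Binary.Pointwise.Inductive using ([]; _∷_)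
import Data.Vec.Relation.Binary.Pointwise.Inductive as Pointwise
open import Data.Vec.Relation.Unary.All using (All; _∷_)
open import Data.Product using (_×_; ∃!; Σ; Σ-syntax; _,_; proj₁; proj₂)
open import Function.Bundles using (_⇔_; mk⇔)
open import Relation.Nullary using (does)
open import Relation.Binary.PropositionalEquality
open ≡-Reasoning

private
  variable
    n r : ℕ

0v : Vec ℕ n
0v = replicate _ 0

e : Fin n → Vec ℕ n
e zero    = 1 ∷ 0v
e (suc j) = 0 ∷ e j

dot : Vec ℕ n → Vec ℕ n → ℕ
dot w x = sum (zipWith _*_ w x)

lookup-ext : {A : Set} {xs ys : Vec A n} → (∀ i → lookup xs i ≡ lookup ys i) → xs ≡ ys
lookup-ext {xs = []}     {[]}     _ = refl
lookup-ext {xs = x ∷ xs} {y ∷ ys} h = cong₂ _∷_ (h zero) (lookup-ext (λ i → h (suc i)))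

tabulate-const : {A : Set} (x : A) → tabulate {n = n} (λ _ → x) ≡ replicate n x
tabulate-const {n = zero}  x = refl
tabulate-const {n = suc n} x = cong (x ∷_) (tabulate-const x)

≤v-refl : {x : Vec ℕ n} → x ≤v x
≤v-refl = Pointwise.refl ≤-refl

≤v-trans : {x y z : Vec ℕ n} → x ≤v y → y ≤v z → x ≤v z
≤v-trans = Pointwise.trans ≤-trans

≤v-irrelevant : {x y : Vec ℕ n} (p q : x ≤v y) → p ≡ q
≤v-irrelevant []       []       = refl
≤v-irrelevant (p ∷ ps) (q ∷ qs) = cong₂ _∷_ (≤-irrelevant p q) (≤v-irrelevant ps qs)

z≤v : {x : Vec ℕ n} → 0v ≤v x
z≤v {x = []}    = []
z≤v {x = _ ∷ _} = z≤n ∷ z≤v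

m≤vn+vm : (x y : Vec ℕ n) → y ≤v (x +v y)
m≤vn+vm []       []       = []
m≤vn+vm (x ∷ xs) (y ∷ ys) = m≤n+m y x ∷ m≤vn+vm xs ys

e≤v : {u : Vec ℕ n} → All (0 <_) u → (j : Fin n) → e j ≤v u
e≤v (0<u ∷ _)  zero    = 0<u ∷ z≤v
e≤v (_ ∷ 0<us) (suc j) = z≤n ∷ e≤v 0<us j

x≡x+vx⇒x≡0v : (x : Vec ℕ n) → x ≡ x +v x → x ≡ 0v
x≡x+vx⇒x≡0v []       _  = refl
x≡x+vx⇒x≡0v (x ∷ xs) eq with ∷-injective eq
... | x≡x+x , xs≡xs+xs =
  cong₂ _∷_ (+-cancelˡ-≡ x x 0 (trans (sym x≡x+x) (sym (+-identityʳ x))))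
            (x≡x+vx⇒x≡0v xs xs≡xs+xs)

sum≡0⇒≡0v : (x : Vec ℕ n) → sum x ≡ 0 → x ≡ 0v
sum≡0⇒≡0v []           _   = refl
sum≡0⇒≡0v (zero ∷ xs)  Σ≡0 = cong (0 ∷_) (sum≡0⇒≡0v xs Σ≡0)

sum≡suc⇒≡e+v : ∀ {m} (x : Vec ℕ n) → sum x ≡ suc m →
               Σ[ j ∈ Fin n ] Σ[ x' ∈ Vec ℕ n ] (x ≡ e j +v x') × sum x' ≡ m
sum≡suc⇒≡e+v (suc k ∷ xs) Σ≡1+m =
  zero , k ∷ xs , cong (suc k ∷_) (sym (zipWith-identityˡ +-identityˡ xs)) , suc-injective Σ≡1+m
sum≡suc⇒≡e+v (zero ∷ xs) Σ≡1+m with sum≡suc⇒≡e+v xs Σ≡1+m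
... | j , x' , refl , Σx'≡m = suc j , 0 ∷ x' , refl , Σx'≡m

dot-comm : (w x : Vec ℕ n) → dot w x ≡ dot x w
dot-comm w x = cong sum (zipWith-comm *-comm w x)

dot-distribˡ-+v : (w x y : Vec ℕ n) → dot w (x +v y) ≡ dot w x + dot w y
dot-distribˡ-+v []       []       []       = refl
dot-distribˡ-+v (w ∷ ws) (x ∷ xs) (y ∷ ys) = begin
  w * (x + y) + dot ws (xs +v ys)             ≡⟨ cong₂ _+_ (*-distribˡ-+ w x y) (dot-distribˡ-+v ws xs ys) ⟩
  (w * x + w * y) + (dot ws xs + dot ws ys)   ≡⟨ interchange (w * x) (w * y) (dot ws xs) (dot ws ys) ⟩
  (w * x + dot ws xs) + (w * y + dot ws ys)   ∎

dot-monoʳ-≤v : (w : Vec ℕ n) {x y : Vec ℕ n} → x ≤v y → dot w x ≤ dot w y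
dot-monoʳ-≤v []       []         = z≤n
dot-monoʳ-≤v (w ∷ ws) (x≤y ∷ xs≤ys) = +-mono-≤ (*-monoʳ-≤ w x≤y) (dot-monoʳ-≤v ws xs≤ys)

dot-zeroʳ : (w : Vec ℕ n) → dot w 0v ≡ 0
dot-zeroʳ []       = refl
dot-zeroʳ (w ∷ ws) = cong₂ _+_ (*-zeroʳ w) (dot-zeroʳ ws)

dot-eʳ : (w : Vec ℕ n) (j : Fin n) → dot w (e j) ≡ lookup w j
dot-eʳ (w ∷ ws) zero    = trans (cong₂ _+_ (*-identityʳ w) (dot-zeroʳ ws)) (+-identityʳ w)
dot-eʳ (w ∷ ws) (suc j) = cong₂ _+_ (*-zeroʳ w) (dot-eʳ ws j)

lookup-· : (M : Matrix r) (x : Vec ℕ r) (i : Fin r) → lookup (M · x) i ≡ dot (lookup M i) x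
lookup-· M x i = lookup-map i _ M

·-distribˡ-+v : (M : Matrix r) (x y : Vec ℕ r) → M · (x +v y) ≡ (M · x) +v (M · y)
·-distribˡ-+v M x y = lookup-ext λ i → begin
  lookup (M · (x +v y)) i                        ≡⟨ lookup-· M (x +v y) i ⟩
  dot (lookup M i) (x +v y)                      ≡⟨ dot-distribˡ-+v (lookup M i) x y ⟩
  dot (lookup M i) x + dot (lookup M i) y        ≡˘⟨ cong₂ _+_ (lookup-· M x i) (lookup-· M y i) ⟩
  lookup (M · x) i + lookup (M · y) i            ≡˘⟨ lookup-zipWith _+_ i (M · x) (M · y) ⟩
  lookup ((M · x) +v (M · y)) i                  ∎

·-monoʳ-≤v : (M : Matrix r) {x y : Vec ℕ r} → x ≤v y → (M · x) ≤v (M · y)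
·-monoʳ-≤v M x≤y = Pointwise.map⁺ {_∼₁_ = _≡_} {_∼₂_ = _≤_} (λ { {w} refl → dot-monoʳ-≤v w x≤y }) (Pointwise.refl refl)

·-zeroʳ : (M : Matrix r) → M · 0v ≡ 0v
·-zeroʳ M = trans (map-cong dot-zeroʳ M) (map-const M 0)

entry≡·e : (M : Matrix r) (i j : Fin r) → lookup (lookup M i) j ≡ lookup (M · e j) i
entry≡·e M i j = trans (sym (dot-eʳ (lookup M i) j)) (sym (lookup-· M (e j) i))

·e-injective : (M N : Matrix r) → (∀ j → M · e j ≡ N · e j) → M ≡ N
·e-injective M N M≗N = lookup-ext λ i → lookup-ext λ j →
  trans (entry≡·e M i j) (trans (cong (λ v → lookup v i) (M≗N j)) (sym (entry≡·e N i j)))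

fromColumns : (Fin r → Vec ℕ r) → Matrix r
fromColumns c = tabulate λ i → tabulate λ j → lookup (c j) i

fromColumns-·e : (c : Fin r → Vec ℕ r) (j : Fin r) → fromColumns c · e j ≡ c j
fromColumns-·e c j = lookup-ext λ i → begin
  lookup (fromColumns c · e j) i             ≡˘⟨ entry≡·e (fromColumns c) i j ⟩
  lookup (lookup (fromColumns c) i) j        ≡⟨ cong (λ row → lookup row j) (lookup∘tabulate _ i) ⟩
  lookup (tabulate λ j → lookup (c j) i) j   ≡⟨ lookup∘tabulate _ j ⟩
  lookup (c j) i                             ∎

lookup-I : (i : Fin r) → lookup (I r) i ≡ e i
lookup-I i = trans (lookup∘tabulate _ i) (row≡e i)
  where
  row≡e : (i : Fin n) → tabulate (λ j → if does (i ≟ j) then 1 else 0) ≡ e i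
  row≡e zero    = cong (1 ∷_) (tabulate-const 0)
  row≡e (suc i) = cong (0 ∷_) (row≡e i)

I-· : (x : Vec ℕ r) → I r · x ≡ x
I-· {r} x = lookup-ext λ i → begin
  lookup (I r · x) i       ≡⟨ lookup-· (I r) x i ⟩
  dot (lookup (I r) i) x   ≡⟨ cong (λ w → dot w x) (lookup-I i) ⟩
  dot (e i) x              ≡⟨ dot-comm (e i) x ⟩
  dot x (e i)              ≡⟨ dot-eʳ x i ⟩
  lookup x i               ∎

module _ {u : Vec ℕ r} where

  E-≡ : {x y : E u} → vec x ≡ vec y → x ≡ y
  E-≡ {x = ⟨ v , p ⟩} {⟨ .v , q ⟩} refl = cong ⟨ v ,_⟩ (≤v-irrelevant p q)

  Additive : (E u → Vec ℕ r) → Set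
  Additive f = ∀ b c (b⊥c : (vec b +v vec c) ≤v u) → f (⊕ u b c b⊥c) ≡ f b +v f c

  additive⇒zero : {f : E u → Vec ℕ r} → Additive f → ∀ x → vec x ≡ 0v → f x ≡ 0v
  additive⇒zero {f} additive ⟨ _ , p ⟩ refl = x≡x+vx⇒x≡0v (f x) (begin
    f x              ≡⟨ cong f (E-≡ (sym 0v+v0v≡0v)) ⟩
    f (⊕ u x x x⊥x)  ≡⟨ additive x x x⊥x ⟩
    f x +v f x       ∎)
    where
    x : E u
    x = ⟨ 0v , p ⟩
    0v+v0v≡0v : (0v +v 0v) ≡ 0v {r}
    0v+v0v≡0v = zipWith-identityˡ +-identityˡ 0v
    x⊥x : (0v +v 0v) ≤v u
    x⊥x = subst (_≤v u) (sym 0v+v0v≡0v) p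

  module _ (positive : All (0 <_) u) where

    e∈E : Fin r → E u
    e∈E j = ⟨ e j , e≤v positive j ⟩

    matrixOf : (E u → Vec ℕ r) → Matrix r
    matrixOf f = fromColumns λ j → f (e∈E j)

    additive⇒matrixOf-· : {f : E u → Vec ℕ r} → Additive f → ∀ x → f x ≡ matrixOf f · vec x
    additive⇒matrixOf-· {f} additive x = by-size (sum (vec x)) x refl
      where
      M : Matrix r
      M = matrixOf f
      by-size : ∀ m x → sum (vec x) ≡ m → f x ≡ M · vec x
      by-size zero x Σx≡0 = begin
        f x         ≡⟨ additive⇒zero additive x x≡0v ⟩
        0v          ≡˘⟨ ·-zeroʳ M ⟩
        M · 0v      ≡˘⟨ cong (M ·_) x≡0v ⟩
        M · vec x   ∎
        where
        x≡0v : vec x ≡ 0v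
        x≡0v = sum≡0⇒≡0v (vec x) Σx≡0
      by-size (suc m) ⟨ v , p ⟩ Σv≡1+m with sum≡suc⇒≡e+v v Σv≡1+m
      ... | j , v' , refl , Σv'≡m = begin
        f ⟨ e j +v v' , p ⟩        ≡⟨ additive (e∈E j) x' p ⟩
        f (e∈E j) +v f x'          ≡˘⟨ cong₂ _+v_ (fromColumns-·e (λ j → f (e∈E j)) j) (sym (by-size m x' Σv'≡m)) ⟩
        (M · e j) +v (M · v')      ≡˘⟨ ·-distribˡ-+v M (e j) v' ⟩
        M · (e j +v v')            ∎
        where
        x' : E u
        x' = ⟨ v' , ≤v-trans (m≤vn+vm (e j) v') p ⟩

    matrixOf-unique : {f : E u → Vec ℕ r} {M : Matrix r} →
                      (∀ x → f x ≡ M · vec x) → matrixOf f ≡ M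
    matrixOf-unique {f} {M} f≗M· = ·e-injective (matrixOf f) M λ j →
      trans (fromColumns-·e (λ j → f (e∈E j)) j) (f≗M· (e∈E j))

module _ {u : Vec ℕ r} (_∘_ : E u → E u → E u) where

  Represents-intro : ∀ {a M} → (∀ x → vec (a ∘ x) ≡ M · vec x) → Represents u _∘_ a M
  Represents-intro {a} a∘≗M· = subst (_≤v u) (a∘≗M· (top u ≤v-refl)) (bound (a ∘ top u ≤v-refl)) , a∘≗M·

  linear⇒S1 : (M : E u → Matrix r) → (∀ a x → vec (a ∘ x) ≡ M a · vec x) → S1 u _∘_
  linear⇒S1 M a∘≗M· a b c b⊥c = subst (_≤v u) a∘[b⊕c]≡ (bound (a ∘ ⊕ u b c b⊥c)) , a∘[b⊕c]≡
    where
    a∘[b⊕c]≡ : vec (a ∘ ⊕ u b c b⊥c) ≡ vec (a ∘ b) +v vec (a ∘ c)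
    a∘[b⊕c]≡ = begin
      vec (a ∘ ⊕ u b c b⊥c)           ≡⟨ a∘≗M· a (⊕ u b c b⊥c) ⟩
      M a · (vec b +v vec c)          ≡⟨ ·-distribˡ-+v (M a) (vec b) (vec c) ⟩
      (M a · vec b) +v (M a · vec c)  ≡˘⟨ cong₂ _+v_ (a∘≗M· a b) (a∘≗M· a c) ⟩
      vec (a ∘ b) +v vec (a ∘ c)      ∎

  S1⇒∃!Represents : All (0 <_) u → S1 u _∘_ → ∀ a → ∃! _≡_ (Represents u _∘_ a)
  S1⇒∃!Represents positive s1 a =
    matrixOf positive f ,
    Represents-intro (additive⇒matrixOf-· positive additive) ,
    λ (_ , f≗M·) → matrixOf-unique positive f≗M·
    where
    f : E u → Vec ℕ r
    f x = vec (a ∘ x)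
    additive : Additive f
    additive b c b⊥c = proj₂ (s1 a b c b⊥c)

  ∃!Represents⇒S1 : (∀ a → ∃! _≡_ (Represents u _∘_ a)) → S1 u _∘_
  ∃!Represents⇒S1 represented =
    linear⇒S1 (λ a → proj₁ (represented a)) (λ a → proj₂ (proj₁ (proj₂ (represented a))))

  S2⇒Represents-top-I : S2 u _∘_ → ∀ p → Represents u _∘_ (top u p) (I r)
  S2⇒Represents-top-I s2 p = Represents-intro λ x → trans (s2 p x) (sym (I-· (vec x)))

  Represents-top-I⇒S2 : (∀ p → Represents u _∘_ (top u p) (I r)) → S2 u _∘_
  Represents-top-I⇒S2 top-I p x = trans (proj₂ (top-I p) x) (I-· (vec x))

module _ {u : Vec ℕ r} (M : E u → Matrix r) (M-bounded : ∀ a → (M a · u) ≤v u) where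

  matrixAction : E u → E u → E u
  matrixAction a x = ⟨ M a · vec x , ≤v-trans (·-monoʳ-≤v (M a) (bound x)) (M-bounded a) ⟩

  matrixAction-S2 : (∀ p → M (top u p) ≡ I r) → S2 u matrixAction
  matrixAction-S2 M-top p x = trans (cong (_· vec x) (M-top p)) (I-· (vec x))

corollary5p4 : ∀ {r : ℕ} (u : Vec ℕ r) → All (0 <_) u →
  (∀ (_∘_ : E u → E u → E u) →
    (S1 u _∘_ × S2 u _∘_) ⇔
    ((∀ a → ∃! _≡_ (Represents u _∘_ a)) ×
     (∀ (p : (u ≤v u)) → Represents u _∘_ (top u p) (I r))))
  ×
  (∀ (M : E u → Matrix r) →
    (∀ a → (M a · u) ≤v u) →
    (∀ (p : (u ≤v u)) → M (top u p) ≡ I r) →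
    Σ (E u → E u → E u) λ _∘_ →
      (∀ a x → vec (a ∘ x) ≡ M a · vec x) × S1 u _∘_ × S2 u _∘_)
corollary5p4 u positive =
  (λ _∘_ → mk⇔
    (λ (s1 , s2) → S1⇒∃!Represents _∘_ positive s1 , S2⇒Represents-top-I _∘_ s2)
    (λ (represented , top-I) → ∃!Represents⇒S1 _∘_ represented , Represents-top-I⇒S2 _∘_ top-I)) ,
  (λ M M-bounded M-top →
    matrixAction M M-bounded ,
    (λ _ _ → refl) ,
    linear⇒S1 (matrixAction M M-bounded) M (λ _ _ → refl) ,
    matrixAction-S2 M M-bounded M-top)
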